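{- $\mathcal{G}_1\subsetneq\mathcal{G}_2$.
   Context: For a word $w$, $\mathrm{alph}(w)$ is the set of letters occurring in $w$ and $|w|_a$ the number of occurrences of $a$; $w$ is $k$-uniform if $|w|_a=k$ for all $a\in\mathrm{alph}(w)$. For letters $a,b$, $\pi_{a,b}$ is the monoid morphism on words with $a\mapsto a$, $b\mapsto b$ and all other letters mapped to the empty word. For words $w,v$ with $\mathrm{alph}(w)=\mathrm{alph}(v)=A$, $G(w,v)$ is the undirected simple graph on vertex set $A$ in which distinct $a,b$ are adjacent iff $\pi_{a,b}(w)=\pi_{a,b}(v)$. For $k\in\mathbb{N}$, $\mathcal{G}_k$ is the set of graphs $G$ for which there exist $k$-uniform words $w,v\in V(G)^\ast$ with $G=G(w,v)$. -}

module Defs where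

open import Data.Nat using (ℕ)
open import Data.Bool using (Bool; true)
open import Data.Fin using (Fin; _≟_)
open import Data.List using (List; filter; length)
open import Data.Product using (Σ; ∃; ∃-syntax; _×_)
open import Relation.Nullary using (¬_)
open import Relation.Nullary.Decidable using (_⊎-dec_)
open import Relation.Binary.PropositionalEquality using (_≡_; _≢_)
open import Function.Bundles using (_⇔_)

record Graph (n : ℕ) : Set where
  field
    adj    : Fin n → Fin n → Bool
    sym    : ∀ a b → adj a b ≡ adj b a
    irrefl : ∀ a → ¬ (adj a a ≡ true)
open Graph public

Word : ℕ → Set
Word n = List (Fin n)

occ : ∀ {n} → Fin n → Word n → ℕ
occ a w = length (filter (_≟ a) w)

proj : ∀ {n} → Fin n → Fin n → Word n → Word n
proj a b w = filter (λ c → (c ≟ a) ⊎-dec (c ≟ b)) w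

-- w is k-uniform with alph(w) = Fin n (every vertex occurs, exactly k times)
UniformOn : ∀ {n} → ℕ → Word n → Set
UniformOn k w = ∀ a → occ a w ≡ k

IsGraphOf : ∀ {n} → Graph n → Word n → Word n → Set
IsGraphOf G w v = ∀ a b → a ≢ b → (adj G a b ≡ true ⇔ proj a b w ≡ proj a b v)

InG : ℕ → ∀ {n} → Graph n → Set
InG k {n} G = ∃[ w ] ∃[ v ] (UniformOn k w × UniformOn k v × IsGraphOf {n} G w v)

module Submission where

open import Defs
open import Data.Nat using (ℕ; suc; _+_; ⌊_/2⌋) renaming (_≟_ to _≟ℕ_)
open import Data.Nat.Properties using (suc-injective; n≡⌊n+n/2⌋)
open import Data.Nat.DivMod using (m%n<n)
open import Data.Bool using (Bool; true; false; not; _∨_)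
open import Data.Bool.Properties using (¬-not; not-involutive; ∨-comm) renaming (_≟_ to _≟ᵇ_)
open import Data.Fin using (Fin; _≟_; toℕ; fromℕ<; #_)
open import Data.Fin.Properties using (all?)
open import Data.List using (List; []; _∷_; _++_; filter; length)
open import Data.List.Properties using (length-++; filter-++; ∷-injectiveˡ; ∷-injectiveʳ; ≡-dec)
open import Data.Product using (Σ; ∃-syntax; _×_; _,_; uncurry)
open import Relation.Nullary using (¬_; Dec; yes; no; does; ¬?; _⊎-dec_; _×-dec_; _→-dec_; contradiction)
open import Relation.Nullary.Decidable using (map′; from-yes; dec-true)
open import Relation.Binary.PropositionalEquality using (_≡_; _≢_; refl; trans; cong; cong₂; module ≡-Reasoning)
import Relation.Binary.PropositionalEquality as ≡
open import Function.Bundles using (_⇔_; mk⇔; Equivalence)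
open import Function.Construct.Composition using (_⇔-∘_)
import Function.Properties.Equivalence as ⇔

-- Inclusion: G(w, v) = G(ww, vv), because π_{a,b}(ww) = π_{a,b}(w) π_{a,b}(w) and a word is
-- determined by its square.  Strictness: a 1-uniform word is a permutation of the alphabet and
-- π_{a,b} of it only records whether a precedes b.  If a – b – c is an induced path of G(w, v),
-- then "a before b" and "b before c" must have opposite truth values in w, since otherwise
-- transitivity of the order would make w and v agree on (a, c) as well.  Around the 5-cycle this
-- truth value would then alternate an odd number of times, which is impossible; yet the 5-cycle
-- is G(w, v) for two explicit 2-uniform words.

_⇔-dec_ : {A B : Set} → Dec A → Dec B → Dec (A ⇔ B)
a? ⇔-dec b? = map′ (uncurry mk⇔) (λ e → Equivalence.to e , Equivalence.from e)
                   ((a? →-dec b?) ×-dec (b? →-dec a?))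

≢-≢⇒≡ : {x y z : Bool} → x ≢ y → y ≢ z → x ≡ z
≢-≢⇒≡ {x} {y} {z} x≢y y≢z = trans (¬-not x≢y) (trans (cong not (¬-not y≢z)) (not-involutive z))

module _ {A : Set} where

  ++-injectiveˡ : (xs ys : List A) {zs ws : List A} →
                  length xs ≡ length ys → xs ++ zs ≡ ys ++ ws → xs ≡ ys
  ++-injectiveˡ []       []       _ _ = refl
  ++-injectiveˡ (x ∷ xs) (y ∷ ys) |xs|≡|ys| eq =
    cong₂ _∷_ (∷-injectiveˡ eq) (++-injectiveˡ xs ys (suc-injective |xs|≡|ys|) (∷-injectiveʳ eq))

  ++-self-injective : (xs ys : List A) → xs ++ xs ≡ ys ++ ys → xs ≡ ys
  ++-self-injective xs ys eq = ++-injectiveˡ xs ys |xs|≡|ys| eq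
    where
    open ≡-Reasoning
    |xs|≡|ys| : length xs ≡ length ys
    |xs|≡|ys| = begin
      length xs                         ≡⟨ n≡⌊n+n/2⌋ (length xs) ⟩
      ⌊ length xs + length xs /2⌋       ≡⟨ cong ⌊_/2⌋ (length-++ xs) ⟨
      ⌊ length (xs ++ xs) /2⌋           ≡⟨ cong (λ zs → ⌊ length zs /2⌋) eq ⟩
      ⌊ length (ys ++ ys) /2⌋           ≡⟨ cong ⌊_/2⌋ (length-++ ys) ⟩
      ⌊ length ys + length ys /2⌋       ≡⟨ n≡⌊n+n/2⌋ (length ys) ⟨
      length ys                         ∎

module _ {n : ℕ} where

  occ-++ : (a : Fin n) (w w′ : Word n) → occ a (w ++ w′) ≡ occ a w + occ a w′
  occ-++ a w w′ = trans (cong length (filter-++ (_≟ a) w w′)) (length-++ (filter (_≟ a) w))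

  proj-++ : (a b : Fin n) (w w′ : Word n) → proj a b (w ++ w′) ≡ proj a b w ++ proj a b w′
  proj-++ a b = filter-++ (λ c → (c ≟ a) ⊎-dec (c ≟ b))

  UniformOn-++ : ∀ {k l} (w w′ : Word n) → UniformOn k w → UniformOn l w′ → UniformOn (k + l) (w ++ w′)
  UniformOn-++ w w′ uw uw′ a = trans (occ-++ a w w′) (cong₂ _+_ (uw a) (uw′ a))

  proj-++-self : (a b : Fin n) (w v : Word n) →
                 proj a b (w ++ w) ≡ proj a b (v ++ v) ⇔ proj a b w ≡ proj a b v
  proj-++-self a b w v rewrite proj-++ a b w w | proj-++ a b v v =
    mk⇔ (++-self-injective _ _) (cong (λ u → u ++ u))

  IsGraphOf-++-self : {G : Graph n} (w v : Word n) → IsGraphOf G w v → IsGraphOf G (w ++ w) (v ++ v)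
  IsGraphOf-++-self w v g a b a≢b = ⇔.sym (proj-++-self a b w v) ⇔-∘ g a b a≢b

  InG-double : ∀ {k} {G : Graph n} → InG k G → InG (k + k) G
  InG-double {G = G} (w , v , uw , uv , g) =
    w ++ w , v ++ v , UniformOn-++ w w uw uw , UniformOn-++ v v uv uv , IsGraphOf-++-self {G} w v g

  precedes : Fin n → Fin n → Word n → Bool
  precedes a b []      = false
  precedes a b (x ∷ w) with x ≟ a | x ≟ b
  ... | yes _ | _     = true
  ... | no _  | yes _ = false
  ... | no _  | no _  = precedes a b w

  precedes-trans : ∀ {x} (a b c : Fin n) (w : Word n) →
                   precedes a b w ≡ x → precedes b c w ≡ x → precedes a c w ≡ x
  precedes-trans a b c []      ab bc = ab
  precedes-trans a b c (y ∷ w) ab bc with y ≟ a | y ≟ b | y ≟ c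
  ... | yes _ | _     | _     = ab
  ... | no _  | yes _ | _     = contradiction (trans ab (≡.sym bc)) λ ()
  ... | no _  | no _  | yes _ = bc
  ... | no _  | no _  | no _  = precedes-trans a b c w ab bc

  ordered : Fin n → Fin n → Bool → Word n
  ordered a b true  = a ∷ b ∷ []
  ordered a b false = b ∷ a ∷ []

  ordered-injective : {a b : Fin n} → a ≢ b → ∀ x y → ordered a b x ≡ ordered a b y → x ≡ y
  ordered-injective a≢b true  true  _  = refl
  ordered-injective a≢b true  false eq = contradiction (∷-injectiveˡ eq) a≢b
  ordered-injective a≢b false true  eq = contradiction (≡.sym (∷-injectiveˡ eq)) a≢b
  ordered-injective a≢b false false _  = refl

  proj-absent : (a b : Fin n) (w : Word n) → occ a w ≡ 0 → occ b w ≡ 0 → proj a b w ≡ []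
  proj-absent a b []      _ _ = refl
  proj-absent a b (x ∷ w) #a≡0 #b≡0 with x ≟ a | x ≟ b
  ... | no _ | no _ = proj-absent a b w #a≡0 #b≡0

  proj-onlyˡ : (a b : Fin n) (w : Word n) → occ a w ≡ 1 → occ b w ≡ 0 → proj a b w ≡ a ∷ []
  proj-onlyˡ a b (x ∷ w) #a≡1 #b≡0 with x ≟ a | x ≟ b
  ... | yes refl | no _ = cong (x ∷_) (proj-absent x b w (suc-injective #a≡1) #b≡0)
  ... | no _     | no _ = proj-onlyˡ a b w #a≡1 #b≡0

  proj-onlyʳ : (a b : Fin n) (w : Word n) → occ a w ≡ 0 → occ b w ≡ 1 → proj a b w ≡ b ∷ []
  proj-onlyʳ a b (x ∷ w) #a≡0 #b≡1 with x ≟ a | x ≟ b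
  ... | no _ | yes refl = cong (x ∷_) (proj-absent a x w #a≡0 (suc-injective #b≡1))
  ... | no _ | no _     = proj-onlyʳ a b w #a≡0 #b≡1

  proj-once : (a b : Fin n) (w : Word n) → a ≢ b → occ a w ≡ 1 → occ b w ≡ 1 →
              proj a b w ≡ ordered a b (precedes a b w)
  proj-once a b (x ∷ w) a≢b #a≡1 #b≡1 with x ≟ a | x ≟ b
  ... | yes refl | yes x≡b = contradiction x≡b a≢b
  ... | yes refl | no _    = cong (x ∷_) (proj-onlyʳ x b w (suc-injective #a≡1) #b≡1)
  ... | no _     | yes refl = cong (x ∷_) (proj-onlyˡ a x w #a≡1 (suc-injective #b≡1))
  ... | no _     | no _    = proj-once a b w a≢b #a≡1 #b≡1

  proj-≡⇔precedes-≡ : {a b : Fin n} (w v : Word n) → a ≢ b → UniformOn 1 w → UniformOn 1 v →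
                      proj a b w ≡ proj a b v ⇔ precedes a b w ≡ precedes a b v
  proj-≡⇔precedes-≡ {a} {b} w v a≢b uw uv = mk⇔
    (λ eq → ordered-injective a≢b _ _ (trans (≡.sym πw) (trans eq πv)))
    (λ eq → trans πw (trans (cong (ordered a b) eq) (≡.sym πv)))
    where
    πw : proj a b w ≡ ordered a b (precedes a b w)
    πw = proj-once a b w a≢b (uw a) (uw b)
    πv : proj a b v ≡ ordered a b (precedes a b v)
    πv = proj-once a b v a≢b (uv a) (uv b)

  adj⇒≢ : (G : Graph n) {a b : Fin n} → adj G a b ≡ true → a ≢ b
  adj⇒≢ G {a} ab refl = irrefl G a ab

  adj⇔precedes-≡ : {G : Graph n} (w v : Word n) → UniformOn 1 w → UniformOn 1 v → IsGraphOf G w v →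
                   {a b : Fin n} → a ≢ b → adj G a b ≡ true ⇔ precedes a b w ≡ precedes a b v
  adj⇔precedes-≡ w v uw uv g a≢b = proj-≡⇔precedes-≡ w v a≢b uw uv ⇔-∘ g _ _ a≢b

  induced-path-alternates : {G : Graph n} (w v : Word n) →
    UniformOn 1 w → UniformOn 1 v → IsGraphOf G w v →
    {a b c : Fin n} → a ≢ c → adj G a b ≡ true → adj G b c ≡ true → adj G a c ≡ false →
    precedes a b w ≢ precedes b c w
  induced-path-alternates {G} w v uw uv g {a} {b} {c} a≢c ab bc ac≡false same =
    contradiction (trans (≡.sym ac≡false) ac) λ ()
    where
    agree : ∀ {x y} → adj G x y ≡ true → precedes x y w ≡ precedes x y v
    agree xy = Equivalence.to (adj⇔precedes-≡ {G} w v uw uv g (adj⇒≢ G xy)) xy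
    in-w : precedes a c w ≡ precedes a b w
    in-w = precedes-trans a b c w refl (≡.sym same)
    in-v : precedes a c v ≡ precedes a b w
    in-v = precedes-trans a b c v (≡.sym (agree ab)) (trans (≡.sym (agree bc)) (≡.sym same))
    ac : adj G a c ≡ true
    ac = Equivalence.from (adj⇔precedes-≡ {G} w v uw uv g a≢c) (trans in-w (≡.sym in-v))

  UniformOn? : ∀ k (w : Word n) → Dec (UniformOn k w)
  UniformOn? k w = all? λ a → occ a w ≟ℕ k

  IsGraphOf? : (G : Graph n) (w v : Word n) → Dec (IsGraphOf G w v)
  IsGraphOf? G w v = all? λ a → all? λ b →
    ¬? (a ≟ b) →-dec ((adj G a b ≟ᵇ true) ⇔-dec ≡-dec _≟_ (proj a b w) (proj a b v))

next : Fin 5 → Fin 5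
next i = fromℕ< (m%n<n (suc (toℕ i)) 5)

C₅ : Graph 5
C₅ = record
  { adj    = λ a b → does (next a ≟ b) ∨ does (next b ≟ a)
  ; sym    = λ a b → ∨-comm (does (next a ≟ b)) (does (next b ≟ a))
  ; irrefl = from-yes (all? λ a → ¬? (does (next a ≟ a) ∨ does (next a ≟ a) ≟ᵇ true))
  }

C₅-adj-next : ∀ i → adj C₅ i (next i) ≡ true
C₅-adj-next i = cong (_∨ does (next (next i) ≟ i)) (dec-true (next i ≟ next i) refl)

C₅-chord : ∀ i → adj C₅ i (next (next i)) ≡ false × i ≢ next (next i)
C₅-chord = from-yes (all? λ i → (adj C₅ i (next (next i)) ≟ᵇ false) ×-dec ¬? (i ≟ next (next i)))

C₅-not-2-colourable : (f : Fin 5 → Bool) → ¬ (∀ i → f i ≢ f (next i))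
C₅-not-2-colourable f alternates = alternates (# 4) (≡.sym (trans (two-steps (# 0)) (two-steps (# 2))))
  where
  two-steps : ∀ i → f i ≡ f (next (next i))
  two-steps i = ≢-≢⇒≡ (alternates i) (alternates (next i))

C₅∉𝒢₁ : ¬ InG 1 C₅
C₅∉𝒢₁ (w , v , uw , uv , g) = C₅-not-2-colourable (λ i → precedes i (next i) w) λ i →
  let chord , i≢next²i = C₅-chord i in
  induced-path-alternates {G = C₅} w v uw uv g i≢next²i (C₅-adj-next i) (C₅-adj-next (next i)) chord

C₅∈𝒢₂ : InG 2 C₅
C₅∈𝒢₂ = w , v , from-yes (UniformOn? 2 w) , from-yes (UniformOn? 2 v) , from-yes (IsGraphOf? C₅ w v)
  where
  w v : Word 5
  w = # 1 ∷ # 4 ∷ # 0 ∷ # 0 ∷ # 3 ∷ # 2 ∷ # 3 ∷ # 4 ∷ # 1 ∷ # 2 ∷ []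
  v = # 4 ∷ # 1 ∷ # 3 ∷ # 2 ∷ # 0 ∷ # 0 ∷ # 1 ∷ # 3 ∷ # 2 ∷ # 4 ∷ []

corollary4 : ((n : ℕ) (G : Graph n) → InG 1 G → InG 2 G)
             × (∃[ n ] Σ (Graph n) (λ G → InG 2 G × ¬ InG 1 G))
corollary4 = (λ n G → InG-double {G = G}) , (5 , C₅ , C₅∈𝒢₂ , C₅∉𝒢₁)
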